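{- Let $f:\mathbb{N}\to\{ -1,1\}$ be a completely multiplicative function such that $f(p)=-1$ for at least one prime $p$, and let $$\varphi:=\sum_{n\in\mathbb{N}}\left(\frac{1+f(n)}{2}\right)\frac{1}{2^n}.$$ Then $\varphi\notin\mathbb{Q}$.
   Context: $\mathbb{N}=\{1,2,3,\ldots\}$. -}

module Defs where

open import Data.Nat as ℕ using (ℕ; zero; suc; _≥_)
open import Data.Nat.Primality using (Prime)
open import Data.Integer as ℤ using (ℤ; +_; -[1+_])
open import Data.Rational as ℚ using (ℚ; 1ℚ; 0ℚ; ½; _+_; _*_; _-_; _<_; ∣_∣; _/_)
open import Data.Product using (Σ; ∃; _×_)
open import Data.Sum using (_⊎_)
open import Relation.Binary.PropositionalEquality using (_≡_)

-- f : ℕ → ℤ is regarded as a function on ℕ = {1,2,3,...}; its value at 0 is irrelevant.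
-- Completely multiplicative, {-1,1}-valued.
IsCompletelyMultiplicativePM1 : (ℕ → ℤ) → Set
IsCompletelyMultiplicativePM1 f =
  (f 1 ≡ + 1)
  × (∀ m n → m ≥ 1 → n ≥ 1 → f (m ℕ.* n) ≡ f m ℤ.* f n)
  × (∀ n → n ≥ 1 → (f n ≡ + 1) ⊎ (f n ≡ -[1+ 0 ]))

half^ : ℕ → ℚ
half^ zero    = 1ℚ
half^ (suc n) = ½ * half^ n

term : (ℕ → ℤ) → ℕ → ℚ
term f n = ((ℤ.+ 1 ℤ.+ f n) / 2) * half^ n

partialSum : (ℕ → ℚ) → ℕ → ℚ
partialSum a zero    = 0ℚ
partialSum a (suc N) = partialSum a N + a (suc N)

SeriesSumsTo : (ℕ → ℚ) → ℚ → Set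
SeriesSumsTo a q =
  ∀ (ε : ℚ) → 0ℚ < ε → ∃ λ N₀ → ∀ N → N ≥ N₀ → ∣ q - partialSum a N ∣ < ε

-- If the series summed to a rational q with denominator b, the integers
-- R N = (q - S N) 2^(N+1) b (S N the partial sums) would stay in [0, 2b] and satisfy
-- R (N+1) = 2 R N - (1 + f (N+1)) b: they are the remainders of the binary long division
-- of q, and f (N+1) is read off from R N. As R takes finitely many values, f is eventually
-- periodic (a remainder equal to 0, b or 2b makes f eventually constant).
-- Complete multiplicativity forbids this: with period e from N on, x = (N+1) e and p x
-- differ by a multiple of e, so f x = f (p x) = f p f x = - f x.
module Submission where

open import Defs
open import Data.Nat as ℕ using (ℕ; zero; suc; _≤′_; ≤′-refl; ≤′-step)
import Data.Nat.Properties as ℕP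
open import Data.Nat.Primality using (Prime; prime⇒nonZero)
open import Data.Integer as ℤ using (ℤ; +_; -[1+_]; 0ℤ; 1ℤ; -1ℤ)
import Data.Integer.Properties as ℤP
import Data.Integer.Solver as ℤ-Solver
open import Data.Fin using (toℕ; fromℕ<)
import Data.Fin.Properties as FinP
open import Data.Product using (∃; ∃₂; _×_; _,_; proj₁; proj₂)
open import Data.Sum using (_⊎_; inj₁; inj₂)
open import Data.Empty using (⊥-elim)
open import Function using (_∘_)
open import Relation.Nullary using (¬_; yes; no)
open import Relation.Binary.PropositionalEquality

EventuallyPeriodic : {A : Set} → (ℕ → A) → Set
EventuallyPeriodic u = ∃₂ λ N e → 0 ℕ.< e × ∀ n → N ℕ.≤ n → u (n ℕ.+ e) ≡ u n

eventuallyPeriodic-suc : {A : Set} {u : ℕ → A} → EventuallyPeriodic (u ∘ suc) → EventuallyPeriodic u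
eventuallyPeriodic-suc (N , e , 0<e , period) =
  suc N , e , 0<e , λ { (suc n) (ℕ.s≤s N≤n) → period n N≤n }

period-* : {A : Set} {u : ℕ → A} {N e : ℕ} → (∀ n → N ℕ.≤ n → u (n ℕ.+ e) ≡ u n) →
           ∀ j n → N ℕ.≤ n → u (n ℕ.+ j ℕ.* e) ≡ u n
period-* {u = u} period zero n N≤n = cong u (ℕP.+-identityʳ n)
period-* {u = u} {N} {e} period (suc j) n N≤n = begin
  u (n ℕ.+ (e ℕ.+ j ℕ.* e)) ≡⟨ cong u (ℕP.+-assoc n e (j ℕ.* e)) ⟨
  u (n ℕ.+ e ℕ.+ j ℕ.* e)   ≡⟨ period-* period j (n ℕ.+ e) (ℕP.≤-trans N≤n (ℕP.m≤m+n n e)) ⟩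
  u (n ℕ.+ e)               ≡⟨ period n N≤n ⟩
  u n                       ∎
  where open ≡-Reasoning

¬eventuallyPeriodic : ∀ {f p} → IsCompletelyMultiplicativePM1 f → Prime p → f p ≡ -1ℤ →
                      ¬ EventuallyPeriodic f
¬eventuallyPeriodic {f} {p} (_ , f-* , f-sign) p-prime fp≡-1 (N , e , 0<e , period) =
  sign≢neg (f-sign x 1≤x) fx≡-fx
  where
  instance
    e≢0 : ℕ.NonZero e
    e≢0 = ℕ.>-nonZero 0<e
    p≢0 : ℕ.NonZero p
    p≢0 = prime⇒nonZero p-prime
  x : ℕ
  x = suc N ℕ.* e
  N<x : N ℕ.< x
  N<x = ℕP.m≤m*n (suc N) e
  1≤x : 1 ℕ.≤ x
  1≤x = ℕP.≤-trans (ℕ.s≤s ℕ.z≤n) N<x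
  x+[p-1]x≡px : x ℕ.+ ℕ.pred p ℕ.* suc N ℕ.* e ≡ p ℕ.* x
  x+[p-1]x≡px = begin
    x ℕ.+ ℕ.pred p ℕ.* suc N ℕ.* e ≡⟨ cong (x ℕ.+_) (ℕP.*-assoc (ℕ.pred p) (suc N) e) ⟩
    suc (ℕ.pred p) ℕ.* x           ≡⟨ cong (ℕ._* x) (ℕP.suc-pred p) ⟩
    p ℕ.* x                        ∎
    where open ≡-Reasoning
  fx≡-fx : f x ≡ ℤ.- f x
  fx≡-fx = begin
    f x                                  ≡⟨ period-* period (ℕ.pred p ℕ.* suc N) x (ℕP.<⇒≤ N<x) ⟨
    f (x ℕ.+ ℕ.pred p ℕ.* suc N ℕ.* e)   ≡⟨ cong f x+[p-1]x≡px ⟩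
    f (p ℕ.* x)                          ≡⟨ f-* p x (ℕ.>-nonZero⁻¹ p) 1≤x ⟩
    f p ℤ.* f x                          ≡⟨ cong (ℤ._* f x) fp≡-1 ⟩
    -1ℤ ℤ.* f x                          ≡⟨ ℤP.-1*i≡-i (f x) ⟩
    ℤ.- f x                              ∎
    where open ≡-Reasoning
  sign≢neg : ∀ {z} → z ≡ 1ℤ ⊎ z ≡ -1ℤ → z ≢ ℤ.- z
  sign≢neg (inj₁ refl) ()
  sign≢neg (inj₂ refl) ()

module _ {u : ℕ → ℤ} (u-sign : ∀ n → u n ≡ 1ℤ ⊎ u n ≡ -1ℤ)
         {B : ℤ} .{{_ : ℤ.Positive B}} {R : ℕ → ℤ}
         (R-bounds : ∀ n → 0ℤ ℤ.≤ R n × R n ℤ.≤ + 2 ℤ.* B)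
         (R-suc : ∀ n → R (suc n) ≡ + 2 ℤ.* R n ℤ.- (1ℤ ℤ.+ u n) ℤ.* B)
         where

  open import Data.Integer using (_+_; _*_; _-_; _≤_; _<_)
  open ℤ-Solver.+-*-Solver

  R-suc-at : ∀ {n z} → u n ≡ z → R (suc n) ≡ + 2 * R n - (1ℤ + z) * B
  R-suc-at {n} refl = R-suc n

  R-suc-+1 : ∀ {n} → u n ≡ 1ℤ → R (suc n) ≡ + 2 * (R n - B)
  R-suc-+1 {n} un≡1 = trans (R-suc-at un≡1)
    (solve 2 (λ r b → con (+ 2) :* r :- con (+ 2) :* b := con (+ 2) :* (r :- b)) refl (R n) B)

  R-suc--1 : ∀ {n} → u n ≡ -1ℤ → R (suc n) ≡ + 2 * R n
  R-suc--1 {n} un≡-1 = trans (R-suc-at un≡-1) (ℤP.+-identityʳ (+ 2 * R n))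

  B≤R : ∀ {n} → u n ≡ 1ℤ → B ≤ R n
  B≤R {n} un≡1 = ℤP.0≤i-j⇒j≤i (ℤP.*-cancelˡ-≤-pos 0ℤ (R n - B) (+ 2)
    (subst (0ℤ ≤_) (R-suc-+1 un≡1) (proj₁ (R-bounds (suc n)))))

  R≤B : ∀ {n} → u n ≡ -1ℤ → R n ≤ B
  R≤B {n} un≡-1 = ℤP.*-cancelˡ-≤-pos (R n) B (+ 2)
    (subst (_≤ + 2 * B) (R-suc--1 un≡-1) (proj₂ (R-bounds (suc n))))

  absorbing : ∀ {v s} → (∀ n → R n ≡ v → u n ≡ s × R (suc n) ≡ v) →
              ∀ {N} → R N ≡ v → EventuallyPeriodic u
  absorbing {v} {s} stay {N} RN≡v = N , 1 , ℕ.s≤s ℕ.z≤n , period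
    where
    R≡v : ∀ {n} → N ≤′ n → R n ≡ v
    R≡v ≤′-refl         = RN≡v
    R≡v (≤′-step N≤′n) = proj₂ (stay _ (R≡v N≤′n))
    u≡s : ∀ n → N ℕ.≤ n → u n ≡ s
    u≡s n N≤n = proj₁ (stay n (R≡v (ℕP.≤⇒≤′ N≤n)))
    period : ∀ n → N ℕ.≤ n → u (n ℕ.+ 1) ≡ u n
    period n N≤n = trans (cong u (ℕP.+-comm n 1))
      (trans (u≡s (suc n) (ℕP.m≤n⇒m≤1+n N≤n)) (sym (u≡s n N≤n)))

  R≡0⇒eventuallyPeriodic : ∀ {N} → R N ≡ 0ℤ → EventuallyPeriodic u
  R≡0⇒eventuallyPeriodic = absorbing stay
    where
    stay : ∀ n → R n ≡ 0ℤ → u n ≡ -1ℤ × R (suc n) ≡ 0ℤ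
    stay n Rn≡0 with u-sign n
    ... | inj₁ un≡1  = ⊥-elim (ℤP.<⇒≱ (ℤP.positive⁻¹ B) (subst (B ≤_) Rn≡0 (B≤R un≡1)))
    ... | inj₂ un≡-1 = un≡-1 , trans (R-suc--1 un≡-1) (cong (+ 2 *_) Rn≡0)

  R≡2B⇒eventuallyPeriodic : ∀ {N} → R N ≡ + 2 * B → EventuallyPeriodic u
  R≡2B⇒eventuallyPeriodic = absorbing stay
    where
    2B≰B : ¬ (+ 2 * B ≤ B)
    2B≰B 2B≤B = ℤP.<⇒≱ (ℤ.+<+ ℕP.≤-refl)
      (ℤP.*-cancelʳ-≤-pos (+ 2) 1ℤ B (subst (+ 2 * B ≤_) (sym (ℤP.*-identityˡ B)) 2B≤B))
    stay : ∀ n → R n ≡ + 2 * B → u n ≡ 1ℤ × R (suc n) ≡ + 2 * B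
    stay n Rn≡2B with u-sign n
    ... | inj₂ un≡-1 = ⊥-elim (2B≰B (subst (_≤ B) Rn≡2B (R≤B un≡-1)))
    ... | inj₁ un≡1  = un≡1 , trans (R-suc-+1 un≡1)
      (trans (cong (λ r → + 2 * (r - B)) Rn≡2B)
             (solve 1 (λ b → con (+ 2) :* (con (+ 2) :* b :- b) := con (+ 2) :* b) refl B))

  R≡B⇒eventuallyPeriodic : ∀ {N} → R N ≡ B → EventuallyPeriodic u
  R≡B⇒eventuallyPeriodic {N} RN≡B with u-sign N
  ... | inj₁ uN≡1  = R≡0⇒eventuallyPeriodic
    (trans (R-suc-+1 uN≡1) (trans (cong (λ r → + 2 * (r - B)) RN≡B) (cong (+ 2 *_) (ℤP.+-inverseʳ B))))
  ... | inj₂ uN≡-1 = R≡2B⇒eventuallyPeriodic (trans (R-suc--1 uN≡-1) (cong (+ 2 *_) RN≡B))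

  +∣R∣≡R : ∀ n → + ℤ.∣ R n ∣ ≡ R n
  +∣R∣≡R n = ℤP.0≤i⇒+∣i∣≡i (proj₁ (R-bounds n))

  digit : ℤ → ℤ
  digit r with B ℤP.<? r
  ... | yes _ = 1ℤ
  ... | no  _ = -1ℤ

  module _ (aperiodic : ¬ EventuallyPeriodic u) where

    u≡digit : ∀ n → u n ≡ digit (R n)
    u≡digit n with B ℤP.<? R n | u-sign n
    ... | yes _   | inj₁ un≡1  = un≡1
    ... | yes B<R | inj₂ un≡-1 = ⊥-elim (ℤP.<⇒≱ B<R (R≤B un≡-1))
    ... | no  _   | inj₂ un≡-1 = un≡-1
    ... | no  B≮R | inj₁ un≡1  =
      ⊥-elim (aperiodic (R≡B⇒eventuallyPeriodic (ℤP.≤-antisym (ℤP.≮⇒≥ B≮R) (B≤R un≡1))))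

    R-suc-digit : ∀ n → R (suc n) ≡ + 2 * R n - (1ℤ + digit (R n)) * B
    R-suc-digit n = R-suc-at (u≡digit n)

    repetition⇒eventuallyPeriodic : ∀ {N e} → 0 ℕ.< e → R (N ℕ.+ e) ≡ R N → EventuallyPeriodic u
    repetition⇒eventuallyPeriodic {N} {e} 0<e R[N+e]≡RN = N , e , 0<e , period
      where
      R-period : ∀ {n} → N ≤′ n → R (n ℕ.+ e) ≡ R n
      R-period ≤′-refl                = R[N+e]≡RN
      R-period (≤′-step {n} N≤′n) = begin
        R (suc (n ℕ.+ e))                                  ≡⟨ R-suc-digit (n ℕ.+ e) ⟩
        + 2 * R (n ℕ.+ e) - (1ℤ + digit (R (n ℕ.+ e))) * B ≡⟨ cong next (R-period N≤′n) ⟩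
        + 2 * R n - (1ℤ + digit (R n)) * B                 ≡⟨ R-suc-digit n ⟨
        R (suc n)                                          ∎
        where
        open ≡-Reasoning
        next : ℤ → ℤ
        next r = + 2 * r - (1ℤ + digit r) * B
      period : ∀ n → N ℕ.≤ n → u (n ℕ.+ e) ≡ u n
      period n N≤n = begin
        u (n ℕ.+ e)         ≡⟨ u≡digit (n ℕ.+ e) ⟩
        digit (R (n ℕ.+ e)) ≡⟨ cong digit (R-period (ℕP.≤⇒≤′ N≤n)) ⟩
        digit (R n)         ≡⟨ u≡digit n ⟨
        u n                 ∎
        where open ≡-Reasoning

    ∣R∣<∣2B∣ : ∀ n → ℤ.∣ R n ∣ ℕ.< ℤ.∣ + 2 * B ∣
    ∣R∣<∣2B∣ n = ℤP.drop‿+<+ (subst₂ _<_ (sym (+∣R∣≡R n)) (sym (ℤP.0≤i⇒+∣i∣≡i 0≤2B))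
                   (ℤP.≤∧≢⇒< R≤2B (aperiodic ∘ R≡2B⇒eventuallyPeriodic)))
      where
      R≤2B : R n ≤ + 2 * B
      R≤2B = proj₂ (R-bounds n)
      0≤2B : 0ℤ ≤ + 2 * B
      0≤2B = ℤP.≤-trans (proj₁ (R-bounds n)) R≤2B

  -- Only doubly negated: whether some remainder ever equals 0, B or 2B is undecidable.
  longDivision-¬¬eventuallyPeriodic : ¬ ¬ EventuallyPeriodic u
  longDivision-¬¬eventuallyPeriodic aperiodic
    with i , j , i<j , Ri≈Rj ← FinP.pigeonhole (ℕP.n<1+n _) (λ i → fromℕ< (∣R∣<∣2B∣ aperiodic (toℕ i)))
    = aperiodic (repetition⇒eventuallyPeriodic aperiodic (ℕP.m<n⇒0<n∸m i<j) R[j]≡R[i])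
    where
    R[j]≡R[i] : R (toℕ i ℕ.+ (toℕ j ℕ.∸ toℕ i)) ≡ R (toℕ i)
    R[j]≡R[i] = begin
      R (toℕ i ℕ.+ (toℕ j ℕ.∸ toℕ i)) ≡⟨ cong R (ℕP.m+[n∸m]≡n (ℕP.<⇒≤ i<j)) ⟩
      R (toℕ j)                       ≡⟨ +∣R∣≡R (toℕ j) ⟨
      + ℤ.∣ R (toℕ j) ∣               ≡⟨ cong +_ (FinP.fromℕ<-injective _ _ _ _ Ri≈Rj) ⟨
      + ℤ.∣ R (toℕ i) ∣               ≡⟨ +∣R∣≡R (toℕ i) ⟩
      R (toℕ i)                       ∎
      where open ≡-Reasoning

open import Data.Rational
  using (ℚ; _+_; _*_; _-_; -_; _≤_; _<_; ∣_∣; _/_; 0ℚ; 1ℚ; ½; mkℚ; ↥_; ↧_; ↧ₙ_; toℚᵘ; NonNegative)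
import Data.Rational.Properties as ℚP
import Data.Rational.Solver as ℚ-Solver
import Data.Rational.Unnormalised as ℚᵘ
open import Data.Rational.Unnormalised using (mkℚᵘ; *≡*; *≤*)
import Data.Rational.Unnormalised.Properties as ℚᵘP

fromℤ : ℤ → ℚ
fromℤ i = i / 1

toℚᵘ-fromℤ : ∀ i → toℚᵘ (fromℤ i) ℚᵘ.≃ mkℚᵘ i 0
toℚᵘ-fromℤ i = ℚP.toℚᵘ-fromℚᵘ (mkℚᵘ i 0)

toℚᵘ≃⇒≡fromℤ : ∀ {p i} → toℚᵘ p ℚᵘ.≃ mkℚᵘ i 0 → p ≡ fromℤ i
toℚᵘ≃⇒≡fromℤ {i = i} p≃i = ℚP.toℚᵘ-injective (ℚᵘP.≃-trans p≃i (ℚᵘP.≃-sym (toℚᵘ-fromℤ i)))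

fromℤ-homo-+ : ∀ i j → fromℤ (i ℤ.+ j) ≡ fromℤ i + fromℤ j
fromℤ-homo-+ i j = sym (toℚᵘ≃⇒≡fromℤ (begin
  toℚᵘ (fromℤ i + fromℤ j)           ≈⟨ ℚP.toℚᵘ-homo-+ (fromℤ i) (fromℤ j) ⟩
  toℚᵘ (fromℤ i) ℚᵘ.+ toℚᵘ (fromℤ j) ≈⟨ ℚᵘP.+-cong (toℚᵘ-fromℤ i) (toℚᵘ-fromℤ j) ⟩
  mkℚᵘ (i ℤ.* 1ℤ ℤ.+ j ℤ.* 1ℤ) 0     ≈⟨ *≡* (cong (ℤ._* 1ℤ) i*1+j*1≡i+j) ⟩
  mkℚᵘ (i ℤ.+ j) 0                   ∎))
  where
  open ℚᵘP.≃-Reasoning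
  i*1+j*1≡i+j : i ℤ.* 1ℤ ℤ.+ j ℤ.* 1ℤ ≡ i ℤ.+ j
  i*1+j*1≡i+j = cong₂ ℤ._+_ (ℤP.*-identityʳ i) (ℤP.*-identityʳ j)

fromℤ-homo-* : ∀ i j → fromℤ (i ℤ.* j) ≡ fromℤ i * fromℤ j
fromℤ-homo-* i j = sym (toℚᵘ≃⇒≡fromℤ
  (ℚᵘP.≃-trans (ℚP.toℚᵘ-homo-* (fromℤ i) (fromℤ j)) (ℚᵘP.*-cong (toℚᵘ-fromℤ i) (toℚᵘ-fromℤ j))))

fromℤ-homo‿- : ∀ i → fromℤ (ℤ.- i) ≡ - fromℤ i
fromℤ-homo‿- i = sym (toℚᵘ≃⇒≡fromℤ
  (ℚᵘP.≃-trans (ℚP.toℚᵘ-homo‿- (fromℤ i)) (ℚᵘP.-‿cong (toℚᵘ-fromℤ i))))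

fromℤ-homo-- : ∀ i j → fromℤ (i ℤ.- j) ≡ fromℤ i - fromℤ j
fromℤ-homo-- i j = trans (fromℤ-homo-+ i (ℤ.- j)) (cong (_+_ (fromℤ i)) (fromℤ-homo‿- j))

fromℤ-cancel-≤ : ∀ {i j} → fromℤ i ≤ fromℤ j → i ℤ.≤ j
fromℤ-cancel-≤ {i} {j} i≤j
  with *≤* i*1≤j*1 ← ℚᵘP.≤-respʳ-≃ (toℚᵘ-fromℤ j) (ℚᵘP.≤-respˡ-≃ (toℚᵘ-fromℤ i) (ℚP.toℚᵘ-mono-≤ i≤j))
  = subst₂ ℤ._≤_ (ℤP.*-identityʳ i) (ℤP.*-identityʳ j) i*1≤j*1

fromℤ-nonNeg : ∀ n → NonNegative (fromℤ (+ n))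
fromℤ-nonNeg n = ℚP.normalize-nonNeg n 1

↥≡*↧ : ∀ q → fromℤ (↥ q) ≡ q * fromℤ (↧ q)
↥≡*↧ q@(mkℚ a d _) = sym (toℚᵘ≃⇒≡fromℤ (begin
  toℚᵘ (q * fromℤ (↧ q))          ≈⟨ ℚP.toℚᵘ-homo-* q (fromℤ (↧ q)) ⟩
  mkℚᵘ a d ℚᵘ.* toℚᵘ (fromℤ (↧ q)) ≈⟨ ℚᵘP.*-congˡ {mkℚᵘ a d} (toℚᵘ-fromℤ (↧ q)) ⟩
  mkℚᵘ a d ℚᵘ.* mkℚᵘ (↧ q) 0       ≈⟨ *≡* (trans (ℤP.*-identityʳ (a ℤ.* ↧ q)) a*↧q≡a*↧q*1) ⟩
  mkℚᵘ a 0                         ∎))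
  where
  open ℚᵘP.≃-Reasoning
  a*↧q≡a*↧q*1 : a ℤ.* ↧ q ≡ a ℤ.* + (↧ₙ q ℕ.* 1)
  a*↧q≡a*↧q*1 = cong (λ n → a ℤ.* + n) (sym (ℕP.*-identityʳ (↧ₙ q)))

p≤∣p∣ : ∀ p → p ≤ ∣ p ∣
p≤∣p∣ p with 0ℚ ℚP.≤? p
... | yes 0≤p = ℚP.≤-reflexive (sym (ℚP.0≤p⇒∣p∣≡p 0≤p))
... | no  0≰p = ℚP.≤-trans (ℚP.<⇒≤ (ℚP.≰⇒> 0≰p)) (ℚP.0≤∣p∣ p)

∣p-q∣≡∣q-p∣ : ∀ p q → ∣ p - q ∣ ≡ ∣ q - p ∣
∣p-q∣≡∣q-p∣ p q = trans (sym (ℚP.∣-p∣≡∣p∣ (p - q)))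
  (cong ∣_∣ (solve 2 (λ p q → :- (p :- q) := q :- p) refl p q))
  where open ℚ-Solver.+-*-Solver

p<q⇒0<q-p : ∀ {p q} → p < q → 0ℚ < q - p
p<q⇒0<q-p {p} {q} p<q = subst (_< q - p) (ℚP.+-inverseʳ p) (ℚP.+-monoˡ-< (- p) p<q)

p≤q⇒0≤q-p : ∀ {p q} → p ≤ q → 0ℚ ≤ q - p
p≤q⇒0≤q-p {p} {q} p≤q = subst (_≤ q - p) (ℚP.+-inverseʳ p) (ℚP.+-monoˡ-≤ (- p) p≤q)

p≤p+q : ∀ p {q} → 0ℚ ≤ q → p ≤ p + q
p≤p+q p {q} 0≤q = subst (_≤ p + q) (ℚP.+-identityʳ p) (ℚP.+-monoʳ-≤ p 0≤q)

module _ {a : ℕ → ℚ} {q : ℚ} (a→q : SeriesSumsTo a q) where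

  private
    S : ℕ → ℚ
    S = partialSum a

  eventually-close : ∀ N {ε} → 0ℚ < ε → ∃ λ M → N ℕ.≤ M × ∣ q - S M ∣ < ε
  eventually-close N 0<ε with N₀ , close ← a→q _ 0<ε =
    N₀ ℕ.+ N , ℕP.m≤n+m N N₀ , close (N₀ ℕ.+ N) (ℕP.m≤m+n N₀ N)

  sumsTo-lowerBound : ∀ {N c} → (∀ M → N ℕ.≤ M → c ≤ S M) → c ≤ q
  sumsTo-lowerBound {N} {c} c≤S with c ℚP.≤? q
  ... | yes c≤q = c≤q
  ... | no  c≰q with M , N≤M , close ← eventually-close N (p<q⇒0<q-p (ℚP.≰⇒> c≰q)) =
    ⊥-elim (ℚP.<-irrefl refl (ℚP.<-≤-trans close (begin
      c - q         ≤⟨ ℚP.+-monoˡ-≤ (- q) (c≤S M N≤M) ⟩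
      S M - q       ≤⟨ p≤∣p∣ (S M - q) ⟩
      ∣ S M - q ∣   ≡⟨ ∣p-q∣≡∣q-p∣ (S M) q ⟩
      ∣ q - S M ∣   ∎)))
    where open ℚP.≤-Reasoning

  sumsTo-upperBound : ∀ {N c} → (∀ M → N ℕ.≤ M → S M ≤ c) → q ≤ c
  sumsTo-upperBound {N} {c} S≤c with q ℚP.≤? c
  ... | yes q≤c = q≤c
  ... | no  q≰c with M , N≤M , close ← eventually-close N (p<q⇒0<q-p (ℚP.≰⇒> q≰c)) =
    ⊥-elim (ℚP.<-irrefl refl (ℚP.<-≤-trans close (begin
      q - c         ≤⟨ ℚP.+-monoʳ-≤ q (ℚP.neg-antimono-≤ (S≤c M N≤M)) ⟩
      q - S M       ≤⟨ p≤∣p∣ (q - S M) ⟩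
      ∣ q - S M ∣   ∎)))
    where open ℚP.≤-Reasoning

half^-nonNeg : ∀ n → NonNegative (half^ n)
half^-nonNeg zero    = _
half^-nonNeg (suc n) = ℚP.nonNeg*nonNeg⇒nonNeg ½ (half^ n) {{half^-nonNeg n}}

0≤half^ : ∀ n → 0ℚ ≤ half^ n
0≤half^ n = ℚP.nonNegative⁻¹ (half^ n) {{half^-nonNeg n}}

half^-suc-+ : ∀ n → half^ (suc n) + half^ (suc n) ≡ half^ n
half^-suc-+ n = trans (sym (ℚP.*-distribʳ-+ (half^ n) ½ ½)) (ℚP.*-identityˡ (half^ n))

module _ {a : ℕ → ℚ} (a-bounds : ∀ n → 0ℚ ≤ a (suc n) × a (suc n) ≤ half^ (suc n)) where

  private
    S : ℕ → ℚ
    S = partialSum a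

  partialSum-mono : ∀ {N M} → N ≤′ M → S N ≤ S M
  partialSum-mono ≤′-refl             = ℚP.≤-refl
  partialSum-mono (≤′-step {M} N≤′M) =
    ℚP.≤-trans (partialSum-mono N≤′M) (p≤p+q (S M) (proj₁ (a-bounds M)))

  partialSum+half^-antimono : ∀ {N M} → N ≤′ M → S M + half^ M ≤ S N + half^ N
  partialSum+half^-antimono ≤′-refl             = ℚP.≤-refl
  partialSum+half^-antimono (≤′-step {M} N≤′M) = ℚP.≤-trans (begin
    S M + a (suc M) + half^ (suc M)
      ≤⟨ ℚP.+-monoˡ-≤ (half^ (suc M)) (ℚP.+-monoʳ-≤ (S M) (proj₂ (a-bounds M))) ⟩
    S M + half^ (suc M) + half^ (suc M)     ≡⟨ ℚP.+-assoc (S M) (half^ (suc M)) (half^ (suc M)) ⟩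
    S M + (half^ (suc M) + half^ (suc M))   ≡⟨ cong (_+_ (S M)) (half^-suc-+ M) ⟩
    S M + half^ M                           ∎) (partialSum+half^-antimono N≤′M)
    where open ℚP.≤-Reasoning

  module _ {q : ℚ} (a→q : SeriesSumsTo a q) where

    partialSum≤sum : ∀ N → S N ≤ q
    partialSum≤sum N = sumsTo-lowerBound a→q {N} (λ M N≤M → partialSum-mono {N} (ℕP.≤⇒≤′ N≤M))

    sum≤partialSum+half^ : ∀ N → q ≤ S N + half^ N
    sum≤partialSum+half^ N = sumsTo-upperBound a→q {N} (λ M N≤M →
      ℚP.≤-trans (p≤p+q (S M) (0≤half^ M)) (partialSum+half^-antimono {N} (ℕP.≤⇒≤′ N≤M)))

pow2 : ℕ → ℚ
pow2 n = fromℤ (+ (2 ℕ.^ n))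

pow2-suc : ∀ n → pow2 (suc n) ≡ fromℤ (+ 2) * pow2 n
pow2-suc n = trans (cong fromℤ (ℤP.pos-* 2 (2 ℕ.^ n))) (fromℤ-homo-* (+ 2) (+ (2 ℕ.^ n)))

half^*pow2 : ∀ n → half^ n * pow2 n ≡ 1ℚ
half^*pow2 zero    = refl
half^*pow2 (suc n) = begin
  ½ * half^ n * pow2 (suc n)              ≡⟨ cong (_*_ (½ * half^ n)) (pow2-suc n) ⟩
  ½ * half^ n * (fromℤ (+ 2) * pow2 n)    ≡⟨ solve 4 (λ a b c d → a :* b :* (c :* d) := a :* c :* (b :* d))
                                                  refl ½ (half^ n) (fromℤ (+ 2)) (pow2 n) ⟩
  ½ * fromℤ (+ 2) * (half^ n * pow2 n)    ≡⟨ cong (_*_ (½ * fromℤ (+ 2))) (half^*pow2 n) ⟩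
  1ℚ                                      ∎
  where open ≡-Reasoning
        open ℚ-Solver.+-*-Solver

digit-cases : ∀ {z} → z ≡ 1ℤ ⊎ z ≡ -1ℤ → ∀ h → (1ℤ ℤ.+ z) / 2 * h ≡ h ⊎ (1ℤ ℤ.+ z) / 2 * h ≡ 0ℚ
digit-cases (inj₁ refl) h = inj₁ (ℚP.*-identityˡ h)
digit-cases (inj₂ refl) h = inj₂ (ℚP.*-zeroˡ h)

digit*2 : ∀ {z} → z ≡ 1ℤ ⊎ z ≡ -1ℤ → (1ℤ ℤ.+ z) / 2 * fromℤ (+ 2) ≡ fromℤ (1ℤ ℤ.+ z)
digit*2 (inj₁ refl) = refl
digit*2 (inj₂ refl) = refl

module _ {f : ℕ → ℤ} (f-sign : ∀ n → f (suc n) ≡ 1ℤ ⊎ f (suc n) ≡ -1ℤ) where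

  private
    S : ℕ → ℚ
    S = partialSum (term f)

  term-bounds : ∀ n → 0ℚ ≤ term f (suc n) × term f (suc n) ≤ half^ (suc n)
  term-bounds n with digit-cases (f-sign n) (half^ (suc n))
  ... | inj₁ t≡h = subst (0ℚ ≤_) (sym t≡h) (0≤half^ (suc n)) , ℚP.≤-reflexive t≡h
  ... | inj₂ t≡0 = ℚP.≤-reflexive (sym t≡0) , subst (_≤ half^ (suc n)) (sym t≡0) (0≤half^ (suc n))

  module _ {q : ℚ} (f→q : SeriesSumsTo (term f) q) where

    R : ℕ → ℤ
    R zero    = + 2 ℤ.* ↥ q
    R (suc N) = + 2 ℤ.* R N ℤ.- (1ℤ ℤ.+ f (suc N)) ℤ.* ↧ q

    scale : ℕ → ℚ
    scale N = pow2 (suc N) * fromℤ (↧ q)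

    remainder : ∀ N → (q - S N) * scale N ≡ fromℤ (R N)
    remainder zero = begin
      (q - 0ℚ) * (fromℤ (+ 2) * fromℤ (↧ q)) ≡⟨ solve 3 (λ q t b → (q :- con 0ℚ) :* (t :* b) := t :* (q :* b))
                                                  refl q (fromℤ (+ 2)) (fromℤ (↧ q)) ⟩
      fromℤ (+ 2) * (q * fromℤ (↧ q))        ≡⟨ cong (_*_ (fromℤ (+ 2))) (↥≡*↧ q) ⟨
      fromℤ (+ 2) * fromℤ (↥ q)              ≡⟨ fromℤ-homo-* (+ 2) (↥ q) ⟨
      fromℤ (+ 2 ℤ.* ↥ q)                    ∎
      where open ≡-Reasoning
            open ℚ-Solver.+-*-Solver
    remainder (suc N) = begin
      (q - (S N + d * h)) * (pow2 (suc (suc N)) * b)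
        ≡⟨ cong (λ x → (q - (S N + d * h)) * (x * b)) (pow2-suc (suc N)) ⟩
      (q - (S N + d * h)) * (two * P * b)
        ≡⟨ solve 7 (λ q s d h two P b → (q :- (s :+ d :* h)) :* (two :* P :* b)
                      := two :* ((q :- s) :* (P :* b)) :- d :* two :* (h :* P) :* b)
                   refl q (S N) d h two P b ⟩
      two * ((q - S N) * scale N) - d * two * (h * P) * b
        ≡⟨ cong₂ (λ x y → two * x - y * b) (remainder N)
                 (cong₂ _*_ (digit*2 (f-sign N)) (half^*pow2 (suc N))) ⟩
      two * fromℤ (R N) - fromℤ e * 1ℚ * b
        ≡⟨ cong (λ x → two * fromℤ (R N) - x * b) (ℚP.*-identityʳ (fromℤ e)) ⟩
      two * fromℤ (R N) - fromℤ e * b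
        ≡⟨ cong₂ _-_ (fromℤ-homo-* (+ 2) (R N)) (fromℤ-homo-* e (↧ q)) ⟨
      fromℤ (+ 2 ℤ.* R N) - fromℤ (e ℤ.* ↧ q)
        ≡⟨ fromℤ-homo-- (+ 2 ℤ.* R N) (e ℤ.* ↧ q) ⟨
      fromℤ (R (suc N))
        ∎
      where
      open ≡-Reasoning
      open ℚ-Solver.+-*-Solver
      e : ℤ
      e = 1ℤ ℤ.+ f (suc N)
      d h two P b : ℚ
      d = e / 2
      h = half^ (suc N)
      two = fromℤ (+ 2)
      P = pow2 (suc N)
      b = fromℤ (↧ q)

    scale-nonNeg : ∀ N → NonNegative (scale N)
    scale-nonNeg N = ℚP.nonNeg*nonNeg⇒nonNeg (pow2 (suc N)) {{fromℤ-nonNeg (2 ℕ.^ suc N)}}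
                                              (fromℤ (↧ q)) {{fromℤ-nonNeg (↧ₙ q)}}

    half^*scale : ∀ N → half^ N * scale N ≡ fromℤ (+ 2 ℤ.* ↧ q)
    half^*scale N = begin
      half^ N * (pow2 (suc N) * b)        ≡⟨ cong (λ x → half^ N * (x * b)) (pow2-suc N) ⟩
      half^ N * (two * pow2 N * b)        ≡⟨ solve 4 (λ h two P b → h :* (two :* P :* b) := h :* P :* (two :* b))
                                                 refl (half^ N) two (pow2 N) b ⟩
      half^ N * pow2 N * (two * b)        ≡⟨ cong (_* (two * b)) (half^*pow2 N) ⟩
      1ℚ * (two * b)                      ≡⟨ ℚP.*-identityˡ (two * b) ⟩
      two * b                             ≡⟨ fromℤ-homo-* (+ 2) (↧ q) ⟨
      fromℤ (+ 2 ℤ.* ↧ q)                 ∎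
      where
      open ≡-Reasoning
      open ℚ-Solver.+-*-Solver
      two b : ℚ
      two = fromℤ (+ 2)
      b = fromℤ (↧ q)

    R-bounds : ∀ N → 0ℤ ℤ.≤ R N × R N ℤ.≤ + 2 ℤ.* ↧ q
    R-bounds N = fromℤ-cancel-≤ (begin
        fromℤ 0ℤ             ≡⟨ ℚP.*-zeroˡ (scale N) ⟨
        0ℚ * scale N         ≤⟨ ℚP.*-monoʳ-≤-nonNeg (scale N) {{scale-nonNeg N}} (p≤q⇒0≤q-p S≤q) ⟩
        (q - S N) * scale N  ≡⟨ remainder N ⟩
        fromℤ (R N)          ∎)
      , fromℤ-cancel-≤ (begin
        fromℤ (R N)          ≡⟨ remainder N ⟨
        (q - S N) * scale N  ≤⟨ ℚP.*-monoʳ-≤-nonNeg (scale N) {{scale-nonNeg N}} q-S≤half^ ⟩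
        half^ N * scale N    ≡⟨ half^*scale N ⟩
        fromℤ (+ 2 ℤ.* ↧ q)  ∎)
      where
      open ℚP.≤-Reasoning
      S≤q : S N ≤ q
      S≤q = partialSum≤sum term-bounds {q} f→q N
      q-S≤half^ : q - S N ≤ half^ N
      q-S≤half^ = begin
        q - S N              ≤⟨ ℚP.+-monoˡ-≤ (- S N) (sum≤partialSum+half^ term-bounds {q} f→q N) ⟩
        S N + half^ N - S N  ≡⟨ solve 2 (λ s h → s :+ h :- s := h) refl (S N) (half^ N) ⟩
        half^ N              ∎
        where open ℚ-Solver.+-*-Solver

    rationalSum⇒¬¬eventuallyPeriodic : ¬ ¬ EventuallyPeriodic f
    rationalSum⇒¬¬eventuallyPeriodic aperiodic =
      longDivision-¬¬eventuallyPeriodic {u = f ∘ suc} f-sign R-bounds (λ _ → refl)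
        (aperiodic ∘ eventuallyPeriodic-suc)

mainTheorem2 : (f : ℕ → ℤ) → IsCompletelyMultiplicativePM1 f
             → (∃ λ p → Prime p × (f p ≡ -[1+ 0 ]))
             → ¬ (∃ λ (q : ℚ) → SeriesSumsTo (term f) q)
mainTheorem2 f f-cm@(_ , _ , f-sign) (p , p-prime , fp≡-1) (q , f→q) =
  rationalSum⇒¬¬eventuallyPeriodic (λ n → f-sign (suc n) (ℕ.s≤s ℕ.z≤n)) {q} f→q
    (¬eventuallyPeriodic f-cm p-prime fp≡-1)
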